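{- Let $n$ be a positive integer and $m_1,\ldots,m_n$ nonnegative integers, and let $f_i(t)$ be as in the context. Then $$f_0(t)=\prod_{j=1}^n\left(\tfrac12 t-\delta_{m_j,0}\right),$$ and $\deg f_i(t)\leqslant m_1+\cdots+m_n+n-i$ for every nonnegative integer $i$.
   Context: The polynomials $f_{mi}(t)\in\mathbb{Q}[t]$, for integers $m\geqslant 0$ and $0\leqslant i\leqslant m+1$, are defined by $f_{00}(t)=\frac12 t-1$, $f_{01}(t)=1$ and, for $m\geqslant 1$: $f_{m0}(t)=tf_{m-1,0}'(t)$; $f_{m,m+1}(t)=-mf_{m-1,m}(t)$; and $f_{mi}(t)=tf'_{m-1,i}(t)+i(1-t)f_{m-1,i}(t)-(i-1)f_{m-1,i-1}(t)$ for $1\leqslant i\leqslant m$. Given $n$ and $m_1,\ldots,m_n$, for each integer $i\geqslant 0$ set $$f_i(t)=\sum_{\substack{i_1+\cdots+i_n=i\\ 0\leqslant i_j\leqslant m_j+1}}f_{m_1i_1}(t)\cdots f_{m_ni_n}(t)$$ (an empty sum is $0$). $\delta$ is the Kronecker delta. -}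

module Defs where

open import Data.Nat as ℕ using (ℕ; zero; suc; _∸_; _≤?_; _≟_)
open import Data.Integer as ℤ using (ℤ; +_)
open import Data.Rational using (ℚ; _/_; 0ℚ; 1ℚ; ½; _+_; _*_; _-_; -_)
open import Data.List as List using (List; []; _∷_; upTo; filter; concatMap)
open import Data.Vec as Vec using (Vec; []; _∷_)
open import Relation.Nullary using (yes; no)

-- Polynomials in ℚ[t], represented by their coefficient sequences:
-- p k is the coefficient of t^k.  Equality of polynomials is pointwise
-- equality of coefficient sequences.
Poly : Set
Poly = ℕ → ℚ

ℕ→ℚ : ℕ → ℚ
ℕ→ℚ k = + k / 1

C : ℚ → Poly
C c zero = c
C c (suc _) = 0ℚ

0ₚ 1ₚ : Poly
0ₚ = C 0ℚ
1ₚ = C 1ℚ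

T : Poly
T (suc zero) = 1ℚ
T _ = 0ℚ

infixl 6 _+ₚ_ _-ₚ_
infixl 7 _*ₚ_ _·ₚ_

_+ₚ_ : Poly → Poly → Poly
(p +ₚ q) k = p k + q k

_·ₚ_ : ℚ → Poly → Poly
(c ·ₚ p) k = c * p k

_-ₚ_ : Poly → Poly → Poly
p -ₚ q = p +ₚ ((- 1ℚ) ·ₚ q)

sumℚ : List ℚ → ℚ
sumℚ = List.foldr _+_ 0ℚ

_*ₚ_ : Poly → Poly → Poly
(p *ₚ q) k = sumℚ (List.map (λ j → p j * q (k ∸ j)) (upTo (suc k)))

D : Poly → Poly
D p k = ℕ→ℚ (suc k) * p (suc k)

-- degree bound: deg p ≤ d (d ∈ ℤ; the zero polynomial has degree -∞,
-- so for negative d this says p = 0)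
DegLe : Poly → ℤ → Set
DegLe p d = ∀ (k : ℕ) → d ℤ.< + k → p k ≡ 0ℚ
  where open import Relation.Binary.PropositionalEquality using (_≡_)

-- f m i = f_{mi}(t) for 0 ≤ i ≤ m+1, and 0 for i > m+1
f : ℕ → ℕ → Poly
f zero zero = ½ ·ₚ T -ₚ 1ₚ
f zero (suc zero) = 1ₚ
f zero (suc (suc _)) = 0ₚ
f (suc m) zero = T *ₚ D (f m zero)
f (suc m) (suc i) with suc i ≤? suc m
... | yes _ = T *ₚ D (f m (suc i))
              +ₚ ℕ→ℚ (suc i) ·ₚ ((1ₚ -ₚ T) *ₚ f m (suc i))
              -ₚ ℕ→ℚ i ·ₚ f m i
... | no _ with i ≟ suc m
...   | yes _ = (- ℕ→ℚ (suc m)) ·ₚ f m (suc m)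
...   | no _ = 0ₚ

tuples : ∀ {n} → Vec ℕ n → List (Vec ℕ n)
tuples [] = [] ∷ []
tuples (m ∷ ms) =
  concatMap (λ a → List.map (a ∷_) (tuples ms)) (upTo (suc (suc m)))

sumₚ : List Poly → Poly
sumₚ = List.foldr _+ₚ_ 0ₚ

prodVₚ : ∀ {k} → Vec Poly k → Poly
prodVₚ = Vec.foldr _ _*ₚ_ 1ₚ

F : ∀ {n} → Vec ℕ n → ℕ → Poly
F ms i = sumₚ (List.map (λ is → prodVₚ (Vec.zipWith f ms is))
                        (filter (λ is → Vec.sum is ≟ i) (tuples ms)))

δ : ℕ → ℕ → ℚ
δ a b with a ≟ b
... | yes _ = 1ℚ
... | no _ = 0ℚ

-- Write "deg p ≤ d" for DegLe p d (d ∈ ℤ).  This relation is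
-- closed under sums, scalar multiples, p ↦ t·p' (which does not raise the
-- degree) and products (degrees add).  By induction on m along the defining
-- recursion this gives deg f_{mi} ≤ m+1-i; hence each summand
-- f_{m_1 i_1}⋯f_{m_n i_n} of f_i has degree ≤ Σ(m_j+1-i_j) = Σm_j + n - i, and so
-- does their sum.
--
-- The only tuple (i_1,…,i_n) with i_1+⋯+i_n = 0 is (0,…,0), so
-- f_0 = ∏_j f_{m_j 0}.  Finally f_{00} = t/2 - 1 and f_{m0} = t/2 for m ≥ 1,
-- since t·(t/2 - c)' = t/2; that is f_{m0} = t/2 - δ_{m,0}.
module Submission where

open import Defs
open import Data.Nat using (ℕ; NonZero)
open import Data.Integer using (+_; _-_)
open import Data.Rational using (½)
open import Data.Vec using (Vec; map; sum)
open import Data.Product using (_×_)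
open import Relation.Binary.PropositionalEquality using (_≡_)

open import Data.Nat as N using (zero; suc; _∸_; _≤?_; _≟_; z<s; s<s)
import Data.Nat.Properties as NP
open import Data.Integer as Z using (ℤ; +<+; +≤+)
import Data.Integer.Properties as ZP
open import Data.Integer.Solver using (module +-*-Solver)
open import Data.Rational as Q using (ℚ; 0ℚ; 1ℚ)
import Data.Rational.Properties as QP
open import Data.List as L using (List; []; _∷_; applyUpTo; filter)
import Data.List.Properties as LP
open import Data.Vec as V using ([]; _∷_)
open import Data.Product using (_,_)
open import Data.Empty using (⊥-elim)
open import Function using (_∘_)
open import Relation.Binary.PropositionalEquality
  using (refl; sym; trans; cong; cong₂; subst; module ≡-Reasoning)
open import Relation.Nullary using (yes; no)
open import Relation.Unary using (Decidable)

_≗ₚ_ : Poly → Poly → Set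
p ≗ₚ q = ∀ k → p k ≡ q k

sumℚ-zeros : (φ : ℕ → ℚ) (g : ℕ → ℕ) (n : ℕ) →
             (∀ x → x N.< n → φ (g x) ≡ 0ℚ) →
             sumℚ (L.map φ (applyUpTo g n)) ≡ 0ℚ
sumℚ-zeros φ g zero _ = refl
sumℚ-zeros φ g (suc n) zeros
  rewrite zeros 0 z<s
        | sumℚ-zeros φ (g ∘ suc) n (λ x x<n → zeros (suc x) (s<s x<n))
  = QP.+-identityʳ 0ℚ

*ₚ-cong : ∀ {p p′ q q′} → p ≗ₚ p′ → q ≗ₚ q′ → (p *ₚ q) ≗ₚ (p′ *ₚ q′)
*ₚ-cong p≗p′ q≗q′ k =
  cong sumℚ (LP.map-cong (λ j → cong₂ Q._*_ (p≗p′ j) (q≗q′ (k ∸ j))) (L.upTo (suc k)))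

T*-coeff-zero : ∀ q → (T *ₚ q) 0 ≡ 0ℚ
T*-coeff-zero q rewrite QP.*-zeroˡ (q 0) = refl

T*-coeff-suc : ∀ q k → (T *ₚ q) (suc k) ≡ q k
T*-coeff-suc q k
  rewrite QP.*-zeroˡ (q (suc k)) | QP.*-identityˡ (q k)
        | sumℚ-zeros (λ j → T j Q.* q (suc k ∸ j)) (suc ∘ suc) k
                     (λ x _ → QP.*-zeroˡ (q (k ∸ suc x)))
        | QP.+-identityʳ (q k)
  = QP.+-identityˡ (q k)

-ₚC-coeff : ∀ p c k → C c k ≡ 0ℚ → (p -ₚ C c) k ≡ p k
-ₚC-coeff p c k c≡0 rewrite c≡0 | QP.*-zeroʳ (Q.- 1ℚ) = QP.+-identityʳ (p k)

deg-mono : ∀ {p d e} → d Z.≤ e → DegLe p d → DegLe p e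
deg-mono d≤e deg-p k e<k = deg-p k (ZP.≤-<-trans d≤e e<k)

deg-0ₚ : ∀ d → DegLe 0ₚ d
deg-0ₚ d zero _ = refl
deg-0ₚ d (suc k) _ = refl

deg-C : ∀ c → DegLe (C c) (+ 0)
deg-C c zero (+<+ ())
deg-C c (suc k) _ = refl

deg-T : DegLe T (+ 1)
deg-T zero (+<+ ())
deg-T (suc zero) (+<+ (N.s≤s ()))
deg-T (suc (suc k)) _ = refl

deg-+ₚ : ∀ {p q d} → DegLe p d → DegLe q d → DegLe (p +ₚ q) d
deg-+ₚ deg-p deg-q k d<k rewrite deg-p k d<k | deg-q k d<k = QP.+-identityʳ 0ℚ

deg-·ₚ : ∀ {p d} c → DegLe p d → DegLe (c ·ₚ p) d
deg-·ₚ c deg-p k d<k rewrite deg-p k d<k = QP.*-zeroʳ c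

deg--ₚ : ∀ {p q d} → DegLe p d → DegLe q d → DegLe (p -ₚ q) d
deg--ₚ deg-p deg-q = deg-+ₚ deg-p (deg-·ₚ (Q.- 1ℚ) deg-q)

deg-T*D : ∀ {p d} → DegLe p d → DegLe (T *ₚ D p) d
deg-T*D {p} deg-p zero _ = T*-coeff-zero (D p)
deg-T*D {p} deg-p (suc k) d<k
  rewrite T*-coeff-suc (D p) k | deg-p (suc k) d<k = QP.*-zeroʳ (ℕ→ℚ (suc k))

-- Degrees add under multiplication: in the coefficient Σ_{j≤k} p_j q_{k-j}
-- with k > d+e, every term has j > d or k-j > e.
deg-*ₚ : ∀ {p q} d e → DegLe p d → DegLe q e → DegLe (p *ₚ q) (d Z.+ e)
deg-*ₚ {p} {q} d e deg-p deg-q k d+e<k = sumℚ-zeros _ (λ x → x) (suc k) term-zero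
  where
  term-zero : ∀ j → j N.< suc k → p j Q.* q (k ∸ j) ≡ 0ℚ
  term-zero j j≤k with d Z.<? + j
  ... | yes d<j rewrite deg-p j d<j = QP.*-zeroˡ (q (k ∸ j))
  ... | no d≮j with e Z.<? + (k ∸ j)
  ...   | yes e<k-j rewrite deg-q (k ∸ j) e<k-j = QP.*-zeroʳ (p j)
  ...   | no e≮k-j = ⊥-elim (ZP.<-irrefl refl (ZP.<-≤-trans d+e<k k≤d+e))
    where
    k≡j+[k-j] : + j Z.+ + (k ∸ j) ≡ + k
    k≡j+[k-j] = cong +_ (NP.m+[n∸m]≡n (NP.≤-pred j≤k))

    k≤d+e : + k Z.≤ d Z.+ e
    k≤d+e = subst (Z._≤ d Z.+ e) k≡j+[k-j] (ZP.+-mono-≤ (ZP.≮⇒≥ d≮j) (ZP.≮⇒≥ e≮k-j))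

open +-*-Solver using (solve; _:+_; _:-_; _:=_; con)

-- (m+2)-(i+1) = (m+1)-i: the bound is stable along the recursion in i.
index-shift : ∀ X Y → (+ 1 Z.+ X) - (+ 1 Z.+ Y) ≡ X - Y
index-shift = solve 2 (λ X Y → (con (+ 1) :+ X) :- (con (+ 1) :+ Y) := X :- Y) refl

-- Multiplying by the linear factor 1 - t adds one to the degree.
one-plus-bound : ∀ X Y → + 1 Z.+ (X - (+ 1 Z.+ Y)) ≡ X - Y
one-plus-bound = solve 2 (λ X Y → con (+ 1) :+ (X :- (con (+ 1) :+ Y)) := X :- Y) refl

deg-1-T : DegLe (1ₚ -ₚ T) (+ 1)
deg-1-T = deg--ₚ (deg-mono (+≤+ N.z≤n) (deg-C 1ℚ)) deg-T

deg-f : ∀ m i → DegLe (f m i) (+ (m N.+ 1) - + i)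
deg-f zero zero = deg--ₚ (deg-·ₚ ½ deg-T) (deg-mono (+≤+ N.z≤n) (deg-C 1ℚ))
deg-f zero (suc zero) = deg-C 1ℚ
deg-f zero (suc (suc i)) = deg-0ₚ _
deg-f (suc m) zero =
  deg-mono (ZP.+-monoˡ-≤ (Z.- + 0) (+≤+ (NP.n≤1+n _))) (deg-T*D (deg-f m 0))
deg-f (suc m) (suc i) with suc i ≤? suc m
... | yes _ =
  subst (DegLe _) (sym (index-shift bound-m (+ i)))
    (deg--ₚ (deg-+ₚ euler-term linear-term) (deg-·ₚ (ℕ→ℚ i) (deg-f m i)))
  where
  bound-m bound-next : ℤ
  bound-m = + (m N.+ 1)
  bound-next = bound-m - (+ 1 Z.+ + i)

  euler-term : DegLe (T *ₚ D (f m (suc i))) (bound-m - + i)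
  euler-term = deg-mono (subst (bound-next Z.≤_) (one-plus-bound bound-m (+ i)) (ZP.i≤suc[i] bound-next))
                        (deg-T*D (deg-f m (suc i)))

  linear-term : DegLe (ℕ→ℚ (suc i) ·ₚ ((1ₚ -ₚ T) *ₚ f m (suc i))) (bound-m - + i)
  linear-term = deg-·ₚ (ℕ→ℚ (suc i))
    (subst (DegLe _) (one-plus-bound bound-m (+ i)) (deg-*ₚ (+ 1) bound-next deg-1-T (deg-f m (suc i))))
... | no _ with i ≟ suc m
...   | yes refl = subst (DegLe _) (sym (index-shift (+ (m N.+ 1)) (+ suc m)))
                         (deg-·ₚ (Q.- ℕ→ℚ (suc m)) (deg-f m (suc m)))
...   | no _ = deg-0ₚ _

-- The bound for a product of f's is the sum of the individual bounds.
bound-additive : ∀ m S n a s →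
  (m Z.+ + 1 - a) Z.+ ((S Z.+ n) - s) ≡ ((m Z.+ S) Z.+ (+ 1 Z.+ n)) - (a Z.+ s)
bound-additive = solve 5 (λ m S n a s →
  (m :+ con (+ 1) :- a) :+ ((S :+ n) :- s) := ((m :+ S) :+ (con (+ 1) :+ n)) :- (a :+ s)) refl

deg-product : ∀ {n} (ms is : Vec ℕ n) →
              DegLe (prodVₚ (V.zipWith f ms is)) (+ (sum ms N.+ n) - + sum is)
deg-product [] [] = deg-C 1ℚ
deg-product {suc n} (m ∷ ms) (a ∷ is) =
  subst (DegLe _) bound-eq (deg-*ₚ _ _ (deg-f m a) (deg-product ms is))
  where
  bound-eq : (+ (m N.+ 1) - + a) Z.+ (+ (sum ms N.+ n) - + sum is)
           ≡ + ((m N.+ sum ms) N.+ suc n) - + (a N.+ sum is)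
  bound-eq rewrite ZP.pos-+ m 1 | ZP.pos-+ (sum ms) n | ZP.pos-+ (m N.+ sum ms) (suc n)
                 | ZP.pos-+ m (sum ms) | ZP.pos-+ a (sum is)
    = bound-additive (+ m) (+ sum ms) (+ n) (+ a) (+ sum is)

deg-sum-over-sum-filter : ∀ {n} (g : Vec ℕ n → Poly) i d (xs : List (Vec ℕ n)) →
  (∀ is → sum is ≡ i → DegLe (g is) d) →
  DegLe (sumₚ (L.map g (filter (λ is → sum is ≟ i) xs))) d
deg-sum-over-sum-filter g i d [] _ = deg-0ₚ d
deg-sum-over-sum-filter g i d (x ∷ xs) deg-g with sum x ≟ i
... | yes x-sums-to-i
  rewrite LP.filter-accept (λ is → sum is ≟ i) {x} {xs} x-sums-to-i =
  deg-+ₚ (deg-g x x-sums-to-i) (deg-sum-over-sum-filter g i d xs deg-g)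
... | no x-does-not
  rewrite LP.filter-reject (λ is → sum is ≟ i) {x} {xs} x-does-not =
  deg-sum-over-sum-filter g i d xs deg-g

sums-to-0? : ∀ {n} → Decidable {A = Vec ℕ n} (λ is → sum is ≡ 0)
sums-to-0? is = sum is ≟ 0

filter-map : ∀ {A B : Set} {P : B → Set} (P? : Decidable P) (g : A → B) (xs : List A) →
             filter P? (L.map g xs) ≡ L.map g (filter (P? ∘ g) xs)
filter-map P? g [] = refl
filter-map P? g (x ∷ xs) with P? (g x)
... | yes _ = cong (g x ∷_) (filter-map P? g xs)
... | no _ = filter-map P? g xs

filter-positive-head : ∀ {n} b (xs : List (Vec ℕ n)) →
                       filter sums-to-0? (L.map (suc b ∷_) xs) ≡ []
filter-positive-head b [] = refl
filter-positive-head b (_ ∷ xs) = filter-positive-head b xs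

filter-positive-heads : ∀ {n} (xs : List (Vec ℕ n)) h k →
  filter sums-to-0? (L.concatMap (λ a → L.map (a ∷_) xs) (applyUpTo (suc ∘ h) k)) ≡ []
filter-positive-heads xs h zero = refl
filter-positive-heads xs h (suc k) =
  trans (LP.filter-++ sums-to-0? (L.map (suc (h 0) ∷_) xs) _)
        (cong₂ L._++_ (filter-positive-head (h 0) xs) (filter-positive-heads xs (h ∘ suc) k))

filter-tuples-sum-0 : ∀ {n} (ms : Vec ℕ n) → filter sums-to-0? (tuples ms) ≡ V.replicate n 0 ∷ []
filter-tuples-sum-0 [] = refl
filter-tuples-sum-0 (m ∷ ms) = begin
  filter sums-to-0? (L.map (0 ∷_) (tuples ms) L.++ rest)
    ≡⟨ LP.filter-++ sums-to-0? (L.map (0 ∷_) (tuples ms)) rest ⟩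
  filter sums-to-0? (L.map (0 ∷_) (tuples ms)) L.++ filter sums-to-0? rest
    ≡⟨ cong₂ L._++_ (filter-map sums-to-0? (0 ∷_) (tuples ms))
                    (filter-positive-heads (tuples ms) (λ x → x) (suc m)) ⟩
  L.map (0 ∷_) (filter sums-to-0? (tuples ms)) L.++ []
    ≡⟨ LP.++-identityʳ _ ⟩
  L.map (0 ∷_) (filter sums-to-0? (tuples ms))
    ≡⟨ cong (L.map (0 ∷_)) (filter-tuples-sum-0 ms) ⟩
  V.replicate _ 0 ∷ [] ∎
  where
  open ≡-Reasoning
  rest : List (Vec ℕ _)
  rest = L.concatMap (λ a → L.map (a ∷_) (tuples ms)) (applyUpTo suc (suc m))

f-0-nonconstant : ∀ m k → f m 0 (suc k) ≡ ½ Q.* T (suc k)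
f-0-nonconstant zero k = -ₚC-coeff (½ ·ₚ T) 1ℚ (suc k) refl
f-0-nonconstant (suc m) zero
  rewrite T*-coeff-suc (D (f m 0)) 0 | f-0-nonconstant m 0 = refl
f-0-nonconstant (suc m) (suc k)
  rewrite T*-coeff-suc (D (f m 0)) (suc k) | f-0-nonconstant m (suc k) | QP.*-zeroʳ ½
  = QP.*-zeroʳ (ℕ→ℚ (suc (suc k)))

f-suc-0 : ∀ m → f (suc m) 0 ≗ₚ (½ ·ₚ T)
f-suc-0 m zero rewrite T*-coeff-zero (D (f m 0)) = sym (QP.*-zeroʳ ½)
f-suc-0 m (suc k) = f-0-nonconstant (suc m) k

f-0 : ∀ m → f m 0 ≗ₚ (½ ·ₚ T -ₚ C (δ m 0))
f-0 zero k = refl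
f-0 (suc m) zero = trans (f-suc-0 m zero) (sym (-ₚC-coeff (½ ·ₚ T) 0ℚ zero refl))
f-0 (suc m) (suc k) = trans (f-suc-0 m (suc k)) (sym (-ₚC-coeff (½ ·ₚ T) 0ℚ (suc k) refl))

product-f-0 : ∀ {n} (ms : Vec ℕ n) →
  prodVₚ (V.zipWith f ms (V.replicate n 0)) ≗ₚ prodVₚ (map (λ m → ½ ·ₚ T -ₚ C (δ m 0)) ms)
product-f-0 [] k = refl
product-f-0 (m ∷ ms) = *ₚ-cong (f-0 m) (product-f-0 ms)

+ₚ-identityʳ : ∀ p → (p +ₚ 0ₚ) ≗ₚ p
+ₚ-identityʳ p zero = QP.+-identityʳ (p zero)
+ₚ-identityʳ p (suc k) = QP.+-identityʳ (p (suc k))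

lemma2p7 : (n : ℕ) → NonZero n → (ms : Vec ℕ n) →
    ((k : ℕ) → F ms 0 k ≡ prodVₚ (map (λ m → ½ ·ₚ T -ₚ C (δ m 0)) ms) k)
    × ((i : ℕ) → DegLe (F ms i) (+ (sum ms Data.Nat.+ n) - + i))
lemma2p7 n _ ms = value-at-0 , degree-bound
  where
  term : Vec ℕ n → Poly
  term is = prodVₚ (V.zipWith f ms is)

  value-at-0 : (k : ℕ) → F ms 0 k ≡ prodVₚ (map (λ m → ½ ·ₚ T -ₚ C (δ m 0)) ms) k
  value-at-0 k = begin
    F ms 0 k                                   ≡⟨ cong (λ xs → sumₚ (L.map term xs) k) (filter-tuples-sum-0 ms) ⟩
    (term (V.replicate n 0) +ₚ 0ₚ) k           ≡⟨ +ₚ-identityʳ (term (V.replicate n 0)) k ⟩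
    term (V.replicate n 0) k                   ≡⟨ product-f-0 ms k ⟩
    prodVₚ (map (λ m → ½ ·ₚ T -ₚ C (δ m 0)) ms) k ∎
    where open ≡-Reasoning

  degree-bound : (i : ℕ) → DegLe (F ms i) (+ (sum ms Data.Nat.+ n) - + i)
  degree-bound i = deg-sum-over-sum-filter term i _ (tuples ms)
    (λ is sum≡i → subst (λ s → DegLe (term is) (+ (sum ms N.+ n) - + s)) sum≡i (deg-product ms is))
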